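{- Let $A\subseteq\omega$ be such that for infinitely many $n$, the intersection of $A$ with the $n$-th ordered block $[b_n,b_{n+1})$ is exactly one of the sub-blocks of that block. Then $A$ is not $0$-weakly stochastic.
   Context: For $n\in\omega$ let $b_n=\frac{4^n-1}{3}=\sum_{i<n}4^i$. The $n$-th ordered block is the interval $[b_n,b_{n+1})$ (of length $4^n$), and for $0\leq i<2^n$ its $i$-th sub-block is $[b_n+i2^n,\,b_n+(i+1)2^n)$. For $B\subseteq\omega$, $\rho_n(B)=\frac{|B\cap\{0,\dots,n-1\}|}{n}$ and $\rho(B)=\lim_n\rho_n(B)$ when it exists. A skip sequence is a finite sequence $((d_0,c_0),\dots,(d_{k-1},c_{k-1}))\in(\omega\times\{0,1\})^{<\omega}$ with $d_0<\dots<d_{k-1}$; a skip rule is a total function $f$ from skip sequences to $\omega$ with $f(\sigma)$ greater than the last first coordinate of $\sigma$ for nonempty $\sigma$. Given $f$ and $A$, put $d_0=f(\emptyset)$, $d_n=f(((d_0,A(d_0)),\dots,(d_{n-1},A(d_{n-1}))))$ and $f(A)=\{n:A(d_n)=1\}$. $A$ is $0$-weakly stochastic if $\rho(f(A))=0$ for every computable skip rule $f$. -}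

module Defs where

open import Data.Nat using (ℕ; zero; suc; _+_; _*_; _^_; _≤_; _<_; ⌊_/2⌋)
open import Data.Bool using (Bool; true; false)
open import Data.Fin using (Fin)
open import Data.Vec using (Vec; []; _∷_; lookup)
open import Data.List using (List; []; _∷_; _++_; last)
open import Data.List.Relation.Unary.Linked using (Linked)
open import Data.Maybe using (just)
open import Data.Product using (Σ; ∃; _×_; _,_; proj₁)
open import Data.Integer using (+_)
open import Data.Rational using (ℚ; _/_; ∣_∣; 0ℚ)
import Data.Rational as Q
open import Relation.Binary.PropositionalEquality using (_≡_)

-- b n = (4^n - 1)/3 = Σ_{i<n} 4^i
b : ℕ → ℕ
b zero    = 0
b (suc n) = b n + 4 ^ n

InBlock : ℕ → ℕ → Set
InBlock n x = b n ≤ x × x < b (suc n)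

InSubBlock : ℕ → ℕ → ℕ → Set
InSubBlock n i x = b n + i * 2 ^ n ≤ x × x < b n + suc i * 2 ^ n

Set⊆ω : Set
Set⊆ω = ℕ → Bool

BlockIsSubBlock : Set⊆ω → ℕ → ℕ → Set
BlockIsSubBlock A n i =
  ∀ x → InBlock n x → ((A x ≡ true → InSubBlock n i x) × (InSubBlock n i x → A x ≡ true))

count : Set⊆ω → ℕ → ℕ
count B zero = 0
count B (suc n) with B n
... | true  = suc (count B n)
... | false = count B n

-- ρ_{m+1}(B)  (ρ_n is only defined for n ≥ 1)
ρsuc : Set⊆ω → ℕ → ℚ
ρsuc B m = (+ count B (suc m)) / suc m

DensityZero : Set⊆ω → Set
DensityZero B = ∀ (ε : ℚ) → 0ℚ Q.< ε →
  Σ ℕ λ N → ∀ m → N ≤ m → ∣ ρsuc B m Q.- 0ℚ ∣ Q.< ε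

SkipSeq : Set
SkipSeq = List (ℕ × Bool)

IsSkipSeq : SkipSeq → Set
IsSkipSeq σ = Linked (λ p q → proj₁ p < proj₁ q) σ

IsSkipRule : (SkipSeq → ℕ) → Set
IsSkipRule f = ∀ σ → IsSkipSeq σ → ∀ p → last σ ≡ just p → proj₁ p < f σ

history : (SkipSeq → ℕ) → Set⊆ω → ℕ → SkipSeq
history f A zero    = []
history f A (suc n) = history f A n ++ ((f (history f A n) , A (f (history f A n))) ∷ [])

query : (SkipSeq → ℕ) → Set⊆ω → ℕ → ℕ
query f A n = f (history f A n)

select : (SkipSeq → ℕ) → Set⊆ω → Set⊆ω
select f A n = A (query f A n)

data Code : ℕ → Set where
  zer  : ∀ {k} → Code k
  succ : Code 1
  proj : ∀ {k} → Fin k → Code k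
  comp : ∀ {k m} → Code m → Vec (Code k) m → Code k
  prec : ∀ {k} → Code k → Code (suc (suc k)) → Code (suc k)
  mu   : ∀ {k} → Code (suc k) → Code k

mutual
  data Eval : ∀ {k} → Code k → Vec ℕ k → ℕ → Set where
    e-zer  : ∀ {k} {xs : Vec ℕ k} → Eval zer xs 0
    e-succ : ∀ {x} → Eval succ (x ∷ []) (suc x)
    e-proj : ∀ {k} {i : Fin k} {xs} → Eval (proj i) xs (lookup xs i)
    e-comp : ∀ {k m} {g : Code m} {hs : Vec (Code k) m} {xs ys y} →
             EvalAll hs xs ys → Eval g ys y → Eval (comp g hs) xs y
    e-prec0 : ∀ {k} {g : Code k} {h xs y} →
              Eval g xs y → Eval (prec g h) (0 ∷ xs) y
    e-precS : ∀ {k} {g : Code k} {h xs n y z} →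
              Eval (prec g h) (n ∷ xs) y → Eval h (n ∷ y ∷ xs) z →
              Eval (prec g h) (suc n ∷ xs) z
    e-mu : ∀ {k} {g : Code (suc k)} {xs n} →
           Eval g (n ∷ xs) 0 →
           (∀ m → m < n → Σ ℕ λ z → Eval g (m ∷ xs) (suc z)) →
           Eval (mu g) xs n

  data EvalAll {k} : ∀ {m} → Vec (Code k) m → Vec ℕ k → Vec ℕ m → Set where
    []  : ∀ {xs} → EvalAll [] xs []
    _∷_ : ∀ {m} {h} {hs : Vec (Code k) m} {xs y ys} →
          Eval h xs y → EvalAll hs xs ys → EvalAll (h ∷ hs) xs (y ∷ ys)

pair : ℕ → ℕ → ℕ
pair a c = ⌊ (a + c) * suc (a + c) /2⌋ + c

bit : Bool → ℕ
bit false = 0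
bit true  = 1

encode : SkipSeq → ℕ
encode []            = 0
encode ((d , c) ∷ σ) = suc (pair (pair d (bit c)) (encode σ))

Computable : (SkipSeq → ℕ) → Set
Computable f = Σ (Code 1) λ e → ∀ σ → Eval e (encode σ ∷ []) (f σ)

ZeroWeaklyStochastic : Set⊆ω → Set
ZeroWeaklyStochastic A =
  ∀ (f : SkipSeq → ℕ) → IsSkipRule f → Computable f → DensityZero (select f A)

module Submission where

-- The rule queries A at 0; after reading a 1 it queries the next position, after reading
-- a 0 it jumps to the start of the next sub-block. Number the sub-blocks of block n by
-- 2 ^ n, …, 2 ^ (n + 1) - 1. Every query that is not selected increases the number of the
-- current sub-block, so of the first k queries at least k minus that number are selected.
-- The rule never jumps over the start of a sub-block, so if A ∩ [b n, b (n + 1)) is the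
-- i-th sub-block, it reaches its start after k₀ ≤ z + 2 ^ (n + 1) queries, z of them
-- selected, and then selects 2 ^ n times in a row. At that point k₀ + 2 ^ n ≤ 4 (z + 2 ^ n)
-- queries have been made, at least a quarter of them selected; as this happens for
-- infinitely many n, the selected set does not have density 0. The rule depends only on
-- the last entry of the skip sequence, which is read off its Gödel code by iterated Cantor
-- unpairing, and so it is μ-recursive.

open import Defs
open import Data.Bool using (Bool; true; false)
open import Data.Empty using (⊥-elim)
open import Data.Fin using (Fin; zero; suc)
open import Data.List using (List; []; _∷_; _++_; last; length)
open import Data.Maybe using (just)
open import Data.Nat using (ℕ; zero; suc; _+_; _*_; _∸_; _^_; _≤_; _<_; pred; z≤n; s≤s; ≢-nonZero; >-nonZero; ⌊_/2⌋)
open import Data.Nat.Properties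
open import Data.Nat.Tactic.RingSolver using (solve-∀)
open import Data.Product using (Σ; ∃; _×_; _,_; proj₁; proj₂)
open import Data.Sum using (_⊎_; inj₁; inj₂; [_,_]′)
open import Data.Vec using (Vec; []; _∷_; lookup; map)
open import Function using (_∘_; id)
open import Relation.Binary.Definitions using (tri<; tri≈; tri>)
open import Relation.Binary.PropositionalEquality
open import Relation.Nullary using (¬_)

import Data.Integer as ℤ
import Data.Integer.Properties as ℤₚ
open import Data.Rational using (∣_∣; 0ℚ)
import Data.Rational as ℚ
import Data.Rational.Properties as ℚₚ
import Data.Rational.Unnormalised as ℚᵘ
import Data.Rational.Unnormalised.Properties as ℚᵘₚ

-- Bounded search and partitions of ℕ into intervals

ifZero : ℕ → ℕ → ℕ → ℕ
ifZero zero    x y = x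
ifZero (suc _) x y = y

-- The least n ≤ B with p n ≡ 0, and B if there is none.
μ≤ : (ℕ → ℕ) → ℕ → ℕ
μ≤ p zero    = zero
μ≤ p (suc B) = ifZero (p 0) 0 (suc (μ≤ (p ∘ suc) B))

μ≤-root : ∀ (p : ℕ → ℕ) B → p B ≡ 0 → p (μ≤ p B) ≡ 0
μ≤-root p zero    root = root
μ≤-root p (suc B) root with p 0 in eq
... | zero  = eq
... | suc _ = μ≤-root (p ∘ suc) B root

μ≤-minimal : ∀ (p : ℕ → ℕ) B {m} → m < μ≤ p B → p m ≢ 0
μ≤-minimal p (suc B) {m} m<μ with p 0 in eq
μ≤-minimal p (suc B) {zero}  m<μ       | suc _ = λ p0≡0 → 0≢1+n (trans (sym p0≡0) eq)
μ≤-minimal p (suc B) {suc m} (s≤s m<μ) | suc _ = μ≤-minimal (p ∘ suc) B m<μ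

record IsPartition (g : ℕ → ℕ) : Set where
  field
    starts-at-zero : g 0 ≡ 0
    monotone       : ∀ {m n} → m ≤ n → g m ≤ g n
    unbounded      : ∀ d → d < g (suc d)

-- The n with g n ≤ d < g (suc n).
index : (ℕ → ℕ) → ℕ → ℕ
index g d = μ≤ (λ n → suc d ∸ g (suc n)) d

module _ {g : ℕ → ℕ} (g-partition : IsPartition g) where
  open IsPartition g-partition

  index-upper : ∀ d → d < g (suc (index g d))
  index-upper d = m∸n≡0⇒m≤n (μ≤-root (λ n → suc d ∸ g (suc n)) d (m≤n⇒m∸n≡0 (unbounded d)))

  index-lower : ∀ d → g (index g d) ≤ d
  index-lower d with index g d in eq
  ... | zero  = ≤-trans (≤-reflexive starts-at-zero) z≤n
  ... | suc k = ≮⇒≥ λ d<g → μ≤-minimal _ d (subst (k <_) (sym eq) (n<1+n k)) (m≤n⇒m∸n≡0 d<g)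

  index-unique : ∀ {n d} → g n ≤ d → d < g (suc n) → index g d ≡ n
  index-unique {n} {d} lower upper with <-cmp (index g d) n
  ... | tri< i<n _ _ = ⊥-elim (<-irrefl refl (<-≤-trans (index-upper d) (≤-trans (monotone i<n) lower)))
  ... | tri≈ _ i≡n _ = i≡n
  ... | tri> _ _ n<i = ⊥-elim (<-irrefl refl (<-≤-trans upper (≤-trans (monotone n<i) (index-lower d))))

  index-mono : ∀ {d d′} → d ≤ d′ → index g d ≤ index g d′
  index-mono {d} {d′} d≤d′ = ≮⇒≥ λ i′<i →
    <-irrefl refl (<-≤-trans (index-upper d′) (≤-trans (monotone i′<i) (≤-trans (index-lower d) d≤d′)))

-- Blocks and sub-blocks

2^n+2^n≡2^[1+n] : ∀ n → 2 ^ n + 2 ^ n ≡ 2 ^ suc n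
2^n+2^n≡2^[1+n] n = cong (2 ^ n +_) (sym (+-identityʳ (2 ^ n)))

n<2^n : ∀ n → n < 2 ^ n
n<2^n zero    = s≤s z≤n
n<2^n (suc n) = subst₂ _≤_ (+-comm (suc n) 1) (2^n+2^n≡2^[1+n] n) (+-mono-≤ (n<2^n n) (m^n>0 2 n))

b-suc : ∀ n → b (suc n) ≡ b n + 2 ^ n * 2 ^ n
b-suc n = cong (b n +_) (4^n≡2^n*2^n n)
  where
  4^n≡2^n*2^n : ∀ n → 4 ^ n ≡ 2 ^ n * 2 ^ n
  4^n≡2^n*2^n zero    = refl
  4^n≡2^n*2^n (suc n) = trans (cong (4 *_) (4^n≡2^n*2^n n)) (square-double (2 ^ n))
    where
    square-double : ∀ x → 4 * (x * x) ≡ (2 * x) * (2 * x)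
    square-double = solve-∀

b-partition : IsPartition b
b-partition = record { starts-at-zero = refl ; monotone = b-mono ; unbounded = n<b[1+n] }
  where
  b-mono : ∀ {m n} → m ≤ n → b m ≤ b n
  b-mono {n = zero}  z≤n = z≤n
  b-mono {n = suc n} m≤1+n with m≤n⇒m<n∨m≡n m≤1+n
  ... | inj₁ (s≤s m≤n) = ≤-trans (b-mono m≤n) (m≤m+n (b n) _)
  ... | inj₂ refl      = ≤-refl

  n<b[1+n] : ∀ n → n < b (suc n)
  n<b[1+n] zero    = s≤s z≤n
  n<b[1+n] (suc n) = subst (_≤ b (suc (suc n))) (+-comm (suc n) 1) (+-mono-≤ (n<b[1+n] n) (m^n>0 4 (suc n)))

scale-partition : ∀ n → IsPartition (_* 2 ^ n)
scale-partition n = record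
  { starts-at-zero = refl
  ; monotone       = *-monoˡ-≤ (2 ^ n)
  ; unbounded      = λ r → m≤m*n (suc r) (2 ^ n) {{m^n≢0 2 n}} }

subBlockStart : ℕ → ℕ → ℕ
subBlockStart n i = b n + i * 2 ^ n

b≤subBlockStart : ∀ n i → b n ≤ subBlockStart n i
b≤subBlockStart n i = m≤m+n (b n) (i * 2 ^ n)

subBlockStart-monoʳ : ∀ n {i j} → i ≤ j → subBlockStart n i ≤ subBlockStart n j
subBlockStart-monoʳ n i≤j = +-monoʳ-≤ (b n) (*-monoˡ-≤ (2 ^ n) i≤j)

subBlockStart-suc : ∀ n i → subBlockStart n (suc i) ≡ subBlockStart n i + 2 ^ n
subBlockStart-suc n i = shift (b n) i (2 ^ n)
  where
  shift : ∀ x i y → x + (y + i * y) ≡ (x + i * y) + y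
  shift = solve-∀

subBlockStart<subBlockStart-suc : ∀ n i → subBlockStart n i < subBlockStart n (suc i)
subBlockStart<subBlockStart-suc n i =
  subst (subBlockStart n i <_) (sym (subBlockStart-suc n i)) (m<m+n _ (m^n>0 2 n))

subBlockStart≤b : ∀ n {i} → i ≤ 2 ^ n → subBlockStart n i ≤ b (suc n)
subBlockStart≤b n i≤2ⁿ = ≤-trans (subBlockStart-monoʳ n i≤2ⁿ) (≤-reflexive (sym (b-suc n)))

subBlockStart-inSubBlock : ∀ n i → InSubBlock n i (subBlockStart n i)
subBlockStart-inSubBlock n i = ≤-refl , subBlockStart<subBlockStart-suc n i

block : ℕ → ℕ
block = index b

subBlock : ℕ → ℕ
subBlock d = index (_* 2 ^ block d) (d ∸ b (block d))

subBlock≡ : ∀ {d n} → block d ≡ n → subBlock d ≡ index (_* 2 ^ n) (d ∸ b n)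
subBlock≡ {d} = cong (λ n → index (_* 2 ^ n) (d ∸ b n))

inSubBlock-position : ∀ d → subBlock d < 2 ^ block d × InSubBlock (block d) (subBlock d) d
inSubBlock-position d = q<2ⁿ , lower , upper
  where
  n r q : ℕ
  n = block d
  r = d ∸ b n
  q = subBlock d
  b+r≡d : b n + r ≡ d
  b+r≡d = m+[n∸m]≡n (index-lower b-partition d)
  r<2ⁿ2ⁿ : r < 2 ^ n * 2 ^ n
  r<2ⁿ2ⁿ = +-cancelˡ-< (b n) r _ (subst₂ _<_ (sym b+r≡d) (b-suc n) (index-upper b-partition d))
  q<2ⁿ : q < 2 ^ n
  q<2ⁿ = *-cancelʳ-< (2 ^ n) q (2 ^ n) (≤-<-trans (index-lower (scale-partition n) r) r<2ⁿ2ⁿ)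
  lower : subBlockStart n q ≤ d
  lower = subst (subBlockStart n q ≤_) b+r≡d (+-monoʳ-≤ (b n) (index-lower (scale-partition n) r))
  upper : d < subBlockStart n (suc q)
  upper = subst (_< subBlockStart n (suc q)) b+r≡d (+-monoʳ-< (b n) (index-upper (scale-partition n) r))

position-unique : ∀ n i {d} → i < 2 ^ n → InSubBlock n i d → block d ≡ n × subBlock d ≡ i
position-unique n i {d} i<2ⁿ (lower , upper) = block≡n , trans (subBlock≡ block≡n) subBlock≡i
  where
  block≡n : block d ≡ n
  block≡n = index-unique b-partition (≤-trans (b≤subBlockStart n i) lower) (<-≤-trans upper (subBlockStart≤b n i<2ⁿ))
  subBlock≡i : index (_* 2 ^ n) (d ∸ b n) ≡ i
  subBlock≡i = index-unique (scale-partition n)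
    (subst (_≤ d ∸ b n) (m+n∸m≡n (b n) _) (∸-monoˡ-≤ (b n) lower))
    (subst (d ∸ b n <_) (m+n∸m≡n (b n) _) (∸-monoˡ-< upper (≤-trans (b≤subBlockStart n i) lower)))

-- One more than the number of sub-blocks before the one containing d.
potential : ℕ → ℕ
potential d = 2 ^ block d + subBlock d

nextSubBlock : ℕ → ℕ
nextSubBlock d = subBlockStart (block d) (suc (subBlock d))

potential-inSubBlock : ∀ n i {d} → i < 2 ^ n → InSubBlock n i d → potential d ≡ 2 ^ n + i
potential-inSubBlock n i i<2ⁿ d∈ with position-unique n i i<2ⁿ d∈
... | block≡n , subBlock≡i = cong₂ (λ n i → 2 ^ n + i) block≡n subBlock≡i

potential-subBlockStart : ∀ n {i} → i ≤ 2 ^ n → potential (subBlockStart n i) ≡ 2 ^ n + i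
potential-subBlockStart n {i} i≤2ⁿ with m≤n⇒m<n∨m≡n i≤2ⁿ
... | inj₁ i<2ⁿ = potential-inSubBlock n i i<2ⁿ (subBlockStart-inSubBlock n i)
... | inj₂ refl = begin
  potential (subBlockStart n (2 ^ n))  ≡⟨ cong potential (subBlockStart≡b[1+n]+0) ⟩
  potential (subBlockStart (suc n) 0)  ≡⟨ potential-inSubBlock (suc n) 0 (m^n>0 2 (suc n)) (subBlockStart-inSubBlock (suc n) 0) ⟩
  2 ^ suc n + 0                        ≡⟨ +-identityʳ _ ⟩
  2 ^ suc n                            ≡⟨ 2^n+2^n≡2^[1+n] n ⟨
  2 ^ n + 2 ^ n                        ∎
  where
  open ≡-Reasoning
  subBlockStart≡b[1+n]+0 : subBlockStart n (2 ^ n) ≡ subBlockStart (suc n) 0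
  subBlockStart≡b[1+n]+0 = trans (sym (b-suc n)) (sym (+-identityʳ _))

potential-nextSubBlock : ∀ d → potential (nextSubBlock d) ≡ suc (potential d)
potential-nextSubBlock d = trans (potential-subBlockStart (block d) (proj₁ (inSubBlock-position d))) (+-suc _ _)

<-nextSubBlock : ∀ d → d < nextSubBlock d
<-nextSubBlock d = proj₂ (proj₂ (inSubBlock-position d))

potential-mono : ∀ {d d′} → d ≤ d′ → potential d ≤ potential d′
potential-mono {d} {d′} d≤d′ with m≤n⇒m<n∨m≡n (index-mono b-partition d≤d′)
... | inj₁ n<n′ = begin
  2 ^ block d + subBlock d    ≤⟨ +-monoʳ-≤ (2 ^ block d) (<⇒≤ (proj₁ (inSubBlock-position d))) ⟩
  2 ^ block d + 2 ^ block d   ≡⟨ 2^n+2^n≡2^[1+n] (block d) ⟩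
  2 ^ suc (block d)           ≤⟨ ^-monoʳ-≤ 2 n<n′ ⟩
  2 ^ block d′                ≤⟨ m≤m+n _ _ ⟩
  2 ^ block d′ + subBlock d′  ∎
  where open ≤-Reasoning
... | inj₂ same = +-mono-≤ (≤-reflexive (cong (2 ^_) same))
  (subst (subBlock d ≤_) (sym (subBlock≡ (sym same)))
         (index-mono (scale-partition (block d)) (∸-monoˡ-≤ (b (block d)) d≤d′)))

nextSubBlock-≤ : ∀ {m i d} → i < 2 ^ m → d < subBlockStart m i → nextSubBlock d ≤ subBlockStart m i
nextSubBlock-≤ {m} {i} {d} i<2ᵐ d<s with inSubBlock-position d | <-cmp (block d) m
... | q<2ⁿ , _ , _     | tri< n<m _ _ =
  ≤-trans (subBlockStart≤b (block d) q<2ⁿ) (≤-trans (IsPartition.monotone b-partition n<m) (b≤subBlockStart m i))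
... | _    , lower , _ | tri≈ _ refl _ =
  subBlockStart-monoʳ m (≰⇒> {i} {subBlock d} λ i≤q →
    <-irrefl refl (<-≤-trans d<s (≤-trans (subBlockStart-monoʳ m i≤q) lower)))
... | _    , lower , _ | tri> _ _ m<n = ⊥-elim (<-irrefl refl (<-≤-trans d<s s≤d))
  where
  s≤d : subBlockStart m i ≤ d
  s≤d = ≤-trans (subBlockStart≤b m (<⇒≤ i<2ᵐ))
          (≤-trans (IsPartition.monotone b-partition m<n) (≤-trans (b≤subBlockStart (block d) (subBlock d)) lower))

-- Decoding skip sequences

triangle : ℕ → ℕ
triangle zero    = 0
triangle (suc s) = triangle s + suc s

pair≡triangle+ : ∀ a c → pair a c ≡ triangle (a + c) + c
pair≡triangle+ a c = cong (_+ c) (begin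
  ⌊ (a + c) * suc (a + c) /2⌋                    ≡⟨ cong ⌊_/2⌋ (triangle-double (a + c)) ⟨
  ⌊ triangle (a + c) + triangle (a + c) /2⌋      ≡⟨ n≡⌊n+n/2⌋ (triangle (a + c)) ⟨
  triangle (a + c)                               ∎)
  where
  open ≡-Reasoning
  triangle-double : ∀ s → triangle s + triangle s ≡ s * suc s
  triangle-double zero    = refl
  triangle-double (suc s) = begin
    (triangle s + suc s) + (triangle s + suc s)  ≡⟨ +-assoc-swap (triangle s) (suc s) ⟩
    (triangle s + triangle s) + (suc s + suc s)  ≡⟨ cong (_+ (suc s + suc s)) (triangle-double s) ⟩
    s * suc s + (suc s + suc s)                  ≡⟨ next-rectangle s ⟩
    suc s * suc (suc s)                          ∎
    where
    +-assoc-swap : ∀ x y → (x + y) + (x + y) ≡ (x + x) + (y + y)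
    +-assoc-swap = solve-∀
    next-rectangle : ∀ s → s * suc s + (suc s + suc s) ≡ suc s * suc (suc s)
    next-rectangle = solve-∀

triangle-partition : IsPartition triangle
triangle-partition = record
  { starts-at-zero = refl ; monotone = triangle-mono ; unbounded = λ s → m≤n+m (suc s) (triangle s) }
  where
  triangle-mono : ∀ {m n} → m ≤ n → triangle m ≤ triangle n
  triangle-mono {zero}          _         = z≤n
  triangle-mono {suc m} {suc n} (s≤s m≤n) = +-mono-≤ (triangle-mono m≤n) (s≤s m≤n)

-- The index of the Cantor diagonal containing x.
diagonal : ℕ → ℕ
diagonal = index triangle

unpairʳ : ℕ → ℕ
unpairʳ x = x ∸ triangle (diagonal x)

unpairˡ : ℕ → ℕ
unpairˡ x = diagonal x ∸ unpairʳ x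

diagonal-pair : ∀ a c → diagonal (pair a c) ≡ a + c
diagonal-pair a c rewrite pair≡triangle+ a c =
  index-unique triangle-partition (m≤m+n _ c) (+-monoʳ-< (triangle (a + c)) (s≤s (m≤n+m c a)))

unpairʳ-pair : ∀ a c → unpairʳ (pair a c) ≡ c
unpairʳ-pair a c rewrite diagonal-pair a c | pair≡triangle+ a c = m+n∸m≡n (triangle (a + c)) c

unpairˡ-pair : ∀ a c → unpairˡ (pair a c) ≡ a
unpairˡ-pair a c rewrite unpairʳ-pair a c | diagonal-pair a c = m+n∸n≡m a c

headCode : ℕ → ℕ
headCode y = unpairˡ (pred y)

tailCode : ℕ → ℕ
tailCode y = unpairʳ (pred y)

headCode-encode : ∀ d c σ → headCode (encode ((d , c) ∷ σ)) ≡ pair d (bit c)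
headCode-encode d c σ = unpairˡ-pair (pair d (bit c)) (encode σ)

tailCode-encode : ∀ p σ → tailCode (encode (p ∷ σ)) ≡ encode σ
tailCode-encode (d , c) σ = unpairʳ-pair (pair d (bit c)) (encode σ)

dropToLast : ℕ → ℕ
dropToLast y = ifZero (tailCode y) y (tailCode y)

dropToLast-singleton : ∀ p → dropToLast (encode (p ∷ [])) ≡ encode (p ∷ [])
dropToLast-singleton p rewrite tailCode-encode p [] = refl

dropToLast-snoc : ∀ q τ p → dropToLast (encode (q ∷ τ ++ p ∷ [])) ≡ encode (τ ++ p ∷ [])
dropToLast-snoc q []      p rewrite tailCode-encode q (p ∷ [])           = refl
dropToLast-snoc q (r ∷ τ) p rewrite tailCode-encode q (r ∷ τ ++ p ∷ []) = refl

iterate : (ℕ → ℕ) → ℕ → ℕ → ℕ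
iterate f zero    x = x
iterate f (suc k) x = f (iterate f k x)

iterate-suc′ : ∀ f k x → iterate f (suc k) x ≡ iterate f k (f x)
iterate-suc′ f zero    x = refl
iterate-suc′ f (suc k) x = cong f (iterate-suc′ f k x)

iterate-fixed : ∀ f k {x} → f x ≡ x → iterate f k x ≡ x
iterate-fixed f zero    fx≡x = refl
iterate-fixed f (suc k) fx≡x = trans (cong f (iterate-fixed f k fx≡x)) fx≡x

iterate-dropToLast : ∀ τ p k → length τ ≤ k → iterate dropToLast k (encode (τ ++ p ∷ [])) ≡ encode (p ∷ [])
iterate-dropToLast []      p k       _         = iterate-fixed dropToLast k (dropToLast-singleton p)
iterate-dropToLast (q ∷ τ) p (suc k) (s≤s τ≤k) = begin
  iterate dropToLast (suc k) (encode (q ∷ τ ++ p ∷ []))        ≡⟨ iterate-suc′ dropToLast k _ ⟩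
  iterate dropToLast k (dropToLast (encode (q ∷ τ ++ p ∷ [])))  ≡⟨ cong (iterate dropToLast k) (dropToLast-snoc q τ p) ⟩
  iterate dropToLast k (encode (τ ++ p ∷ []))                   ≡⟨ iterate-dropToLast τ p k τ≤k ⟩
  encode (p ∷ [])                                               ∎
  where open ≡-Reasoning

length≤encode : ∀ σ → length σ ≤ encode σ
length≤encode []            = z≤n
length≤encode ((d , c) ∷ σ) = s≤s (≤-trans (length≤encode σ) encode≤pair)
  where
  encode≤pair : encode σ ≤ pair (pair d (bit c)) (encode σ)
  encode≤pair = subst (encode σ ≤_) (sym (pair≡triangle+ (pair d (bit c)) (encode σ))) (m≤n+m _ _)

-- The code of σ is at least its length, so this many steps reach the last entry.
lastCode : ℕ → ℕ
lastCode y = iterate dropToLast y y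

lastCode-encode : ∀ τ p → lastCode (encode (τ ++ p ∷ [])) ≡ encode (p ∷ [])
lastCode-encode τ p = iterate-dropToLast τ p _ (≤-trans (length≤length-snoc τ) (length≤encode (τ ++ p ∷ [])))
  where
  length≤length-snoc : ∀ (τ : SkipSeq) → length τ ≤ length (τ ++ p ∷ [])
  length≤length-snoc []      = z≤n
  length≤length-snoc (_ ∷ τ) = s≤s (length≤length-snoc τ)

-- The skip rule

next : ℕ → Bool → ℕ
next d true  = suc d
next d false = nextSubBlock d

<-next : ∀ d c → d < next d c
<-next d true  = n<1+n d
<-next d false = <-nextSubBlock d

next-≤ : ∀ {m i} → i < 2 ^ m → ∀ {d} c → d < subBlockStart m i → next d c ≤ subBlockStart m i
next-≤ i<2ᵐ true  d<s = d<s
next-≤ {m} i<2ᵐ false d<s = nextSubBlock-≤ {m} i<2ᵐ d<s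

potential-next : ∀ d c → suc (potential d) ≤ bit c + potential (next d c)
potential-next d true  = s≤s (potential-mono (n≤1+n d))
potential-next d false = ≤-reflexive (sym (potential-nextSubBlock d))

nextFromHead : ℕ → ℕ
nextFromHead h = ifZero (unpairʳ h) (nextSubBlock (unpairˡ h)) (suc (unpairˡ h))

nextFromHead-pair : ∀ d c → nextFromHead (pair d (bit c)) ≡ next d c
nextFromHead-pair d true  rewrite unpairˡ-pair d 1 | unpairʳ-pair d 1 = refl
nextFromHead-pair d false rewrite unpairˡ-pair d 0 | unpairʳ-pair d 0 = refl

skipRule : SkipSeq → ℕ
skipRule σ = ifZero (encode σ) 0 (nextFromHead (headCode (lastCode (encode σ))))

skipRule-snoc : ∀ τ d c → skipRule (τ ++ (d , c) ∷ []) ≡ next d c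
skipRule-snoc τ d c = begin
  ifZero x 0 (nextFromHead (headCode (lastCode x)))  ≡⟨ ifZero-encode-snoc τ ⟩
  nextFromHead (headCode (lastCode x))               ≡⟨ cong (nextFromHead ∘ headCode) (lastCode-encode τ (d , c)) ⟩
  nextFromHead (headCode (encode ((d , c) ∷ [])))    ≡⟨ cong nextFromHead (headCode-encode d c []) ⟩
  nextFromHead (pair d (bit c))                      ≡⟨ nextFromHead-pair d c ⟩
  next d c                                           ∎
  where
  open ≡-Reasoning
  x : ℕ
  x = encode (τ ++ (d , c) ∷ [])
  ifZero-encode-snoc : ∀ τ {y z} → ifZero (encode (τ ++ (d , c) ∷ [])) y z ≡ z
  ifZero-encode-snoc []      = refl
  ifZero-encode-snoc (_ ∷ _) = refl

last≡just⇒snoc : ∀ {A : Set} {p} (σ : List A) → last σ ≡ just p → ∃ λ τ → σ ≡ τ ++ p ∷ []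
last≡just⇒snoc (q ∷ [])    refl = [] , refl
last≡just⇒snoc (q ∷ r ∷ σ) last≡p with last≡just⇒snoc (r ∷ σ) last≡p
... | τ , r∷σ≡τ++p = q ∷ τ , cong (q ∷_) r∷σ≡τ++p

skipRule-isSkipRule : IsSkipRule skipRule
skipRule-isSkipRule σ _ (d , c) last≡p with last≡just⇒snoc σ last≡p
... | τ , refl = subst (d <_) (sym (skipRule-snoc τ d c)) (<-next d c)

-- μ-recursive realisers

record Realised (k : ℕ) : Set where
  field
    code      : Code k
    ⟦_⟧       : Vec ℕ k → ℕ
    evaluates : ∀ xs → Eval code xs (⟦_⟧ xs)
open Realised

⟦_⟧₁ : Realised 1 → ℕ → ℕ
⟦ F ⟧₁ x = ⟦ F ⟧ (x ∷ [])

-- Lets the semantics of a realiser be any pointwise equal function, so that the realisers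
-- below compute their namesakes definitionally.
castᴿ : ∀ {k} (F : Realised k) (f : Vec ℕ k → ℕ) → (∀ xs → ⟦ F ⟧ xs ≡ f xs) → Realised k
castᴿ F f F≗f = record
  { code = code F ; ⟦_⟧ = f ; evaluates = λ xs → subst (Eval (code F) xs) (F≗f xs) (evaluates F xs) }

zeroᴿ : ∀ {k} → Realised k
zeroᴿ = record { code = zer ; ⟦_⟧ = λ _ → 0 ; evaluates = λ _ → e-zer }

succᴿ : Realised 1
succᴿ = record { code = succ ; ⟦_⟧ = λ { (x ∷ []) → suc x } ; evaluates = λ { (x ∷ []) → e-succ } }

projᴿ : ∀ {k} → Fin k → Realised k
projᴿ i = record { code = proj i ; ⟦_⟧ = λ xs → lookup xs i ; evaluates = λ _ → e-proj }

evaluatesAll : ∀ {k m} (Hs : Vec (Realised k) m) xs → EvalAll (map code Hs) xs (map (λ H → ⟦ H ⟧ xs) Hs)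
evaluatesAll []       xs = []
evaluatesAll (H ∷ Hs) xs = evaluates H xs ∷ evaluatesAll Hs xs

compᴿ : ∀ {k m} → Realised m → Vec (Realised k) m → Realised k
compᴿ G Hs = record
  { code      = comp (code G) (map code Hs)
  ; ⟦_⟧       = λ xs → ⟦ G ⟧ (map (λ H → ⟦ H ⟧ xs) Hs)
  ; evaluates = λ xs → e-comp (evaluatesAll Hs xs) (evaluates G _) }

primRec : ∀ {k} → Realised k → Realised (suc (suc k)) → ℕ → Vec ℕ k → ℕ
primRec G H zero    xs = ⟦ G ⟧ xs
primRec G H (suc n) xs = ⟦ H ⟧ (n ∷ primRec G H n xs ∷ xs)

primRec-evaluates : ∀ {k} (G : Realised k) H n xs → Eval (prec (code G) (code H)) (n ∷ xs) (primRec G H n xs)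
primRec-evaluates G H zero    xs = e-prec0 (evaluates G xs)
primRec-evaluates G H (suc n) xs = e-precS (primRec-evaluates G H n xs) (evaluates H _)

precᴿ : ∀ {k} → Realised k → Realised (suc (suc k)) → Realised (suc k)
precᴿ G H = record
  { code      = prec (code G) (code H)
  ; ⟦_⟧       = λ { (n ∷ xs) → primRec G H n xs }
  ; evaluates = λ { (n ∷ xs) → primRec-evaluates G H n xs } }

≢0⇒≡suc : ∀ {n} → n ≢ 0 → ∃ λ m → n ≡ suc m
≢0⇒≡suc {n} n≢0 = pred n , sym (suc-pred n {{≢-nonZero n≢0}})

-- Unbounded minimisation, made total by a bound at which G is known to vanish.
minᴿ : ∀ {k} (G : Realised (suc k)) (bound : Vec ℕ k → ℕ) →
       (∀ xs → ⟦ G ⟧ (bound xs ∷ xs) ≡ 0) → Realised k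
minᴿ G bound root = record
  { code      = mu (code G)
  ; ⟦_⟧       = λ xs → μ≤ (λ n → ⟦ G ⟧ (n ∷ xs)) (bound xs)
  ; evaluates = λ xs →
      e-mu (subst (Eval (code G) _) (μ≤-root (λ n → ⟦ G ⟧ (n ∷ xs)) (bound xs) (root xs)) (evaluates G _))
           (λ m m<μ → let z , eq = ≢0⇒≡suc (μ≤-minimal (λ n → ⟦ G ⟧ (n ∷ xs)) (bound xs) m<μ)
                      in z , subst (Eval (code G) _) eq (evaluates G _)) }

π₀ : ∀ {k} → Realised (suc k)
π₀ = projᴿ zero

π₁ : ∀ {k} → Realised (suc (suc k))
π₁ = projᴿ (suc zero)

π₂ : ∀ {k} → Realised (suc (suc (suc k)))
π₂ = projᴿ (suc (suc zero))

_⟨_⟩₁ : ∀ {k} → Realised 1 → Realised k → Realised k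
F ⟨ G ⟩₁ = compᴿ F (G ∷ [])

_⟨_,_⟩₂ : ∀ {k} → Realised 2 → Realised k → Realised k → Realised k
F ⟨ G , H ⟩₂ = compᴿ F (G ∷ H ∷ [])

_⟨_,_,_⟩₃ : ∀ {k} → Realised 3 → Realised k → Realised k → Realised k → Realised k
F ⟨ G , H , I ⟩₃ = compᴿ F (G ∷ H ∷ I ∷ [])

unary : (ℕ → ℕ) → Vec ℕ 1 → ℕ
unary f (x ∷ []) = f x

binary : (ℕ → ℕ → ℕ) → Vec ℕ 2 → ℕ
binary f (x ∷ y ∷ []) = f x y

constᴿ : ∀ {k} → ℕ → Realised k
constᴿ c = castᴿ (numeral c) (λ _ → c) (λ _ → numeral-value c)
  where
  numeral : ∀ {k} → ℕ → Realised k
  numeral zero    = zeroᴿ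
  numeral (suc c) = succᴿ ⟨ numeral c ⟩₁

  numeral-value : ∀ {k} {xs : Vec ℕ k} c → ⟦ numeral c ⟧ xs ≡ c
  numeral-value zero    = refl
  numeral-value (suc c) = cong suc (numeral-value c)

+ᴿ : Realised 2
+ᴿ = castᴿ (precᴿ π₀ (succᴿ ⟨ π₁ ⟩₁)) (binary _+_) λ { (x ∷ y ∷ []) → sum x y }
  where
  sum : ∀ x y → primRec π₀ (succᴿ ⟨ π₁ ⟩₁) x (y ∷ []) ≡ x + y
  sum zero    y = refl
  sum (suc x) y = cong suc (sum x y)

*ᴿ : Realised 2
*ᴿ = castᴿ (precᴿ zeroᴿ (+ᴿ ⟨ π₂ , π₁ ⟩₂)) (binary _*_) λ { (x ∷ y ∷ []) → product x y }
  where
  product : ∀ x y → primRec zeroᴿ (+ᴿ ⟨ π₂ , π₁ ⟩₂) x (y ∷ []) ≡ x * y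
  product zero    y = refl
  product (suc x) y = cong (y +_) (product x y)

predᴿ : Realised 1
predᴿ = castᴿ (precᴿ zeroᴿ π₀) (unary pred) λ { (zero ∷ []) → refl ; (suc x ∷ []) → refl }

∸ᴿ : Realised 2
∸ᴿ = castᴿ (monus ⟨ π₁ , π₀ ⟩₂) (binary _∸_) λ { (x ∷ y ∷ []) → difference x y }
  where
  monus : Realised 2
  monus = precᴿ π₀ (predᴿ ⟨ π₁ ⟩₁)

  difference : ∀ x y → primRec π₀ (predᴿ ⟨ π₁ ⟩₁) y (x ∷ []) ≡ x ∸ y
  difference x zero    = refl
  difference x (suc y) = trans (cong pred (difference x y)) (pred[m∸n]≡m∸[1+n] x y)

ifZeroᴿ : Realised 3
ifZeroᴿ = castᴿ (precᴿ π₀ (projᴿ (suc (suc (suc zero)))))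
                (λ { (c ∷ x ∷ y ∷ []) → ifZero c x y })
                λ { (zero ∷ x ∷ y ∷ []) → refl ; (suc c ∷ x ∷ y ∷ []) → refl }

recursionᴿ : (g : ℕ → ℕ) (H : Realised 2) → (∀ n → g (suc n) ≡ ⟦ H ⟧ (n ∷ g n ∷ [])) → Realised 1
recursionᴿ g H g-suc = castᴿ (precᴿ (constᴿ (g 0)) H) (unary g) λ { (n ∷ []) → recursion n }
  where
  recursion : ∀ n → primRec (constᴿ (g 0)) H n [] ≡ g n
  recursion zero    = refl
  recursion (suc n) = trans (cong (λ r → ⟦ H ⟧ (n ∷ r ∷ [])) (recursion n)) (sym (g-suc n))

iterateᴿ : Realised 1 → Realised 2
iterateᴿ F = castᴿ (precᴿ π₀ (F ⟨ π₁ ⟩₁)) (binary (iterate ⟦ F ⟧₁)) λ { (k ∷ x ∷ []) → iteration k x }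
  where
  iteration : ∀ k x → primRec π₀ (F ⟨ π₁ ⟩₁) k (x ∷ []) ≡ iterate ⟦ F ⟧₁ k x
  iteration zero    x = refl
  iteration (suc k) x = cong (λ r → ⟦ F ⟧ (r ∷ [])) (iteration k x)

^ᴿ : ℕ → Realised 1
^ᴿ c = recursionᴿ (c ^_) (*ᴿ ⟨ constᴿ c , π₁ ⟩₂) λ _ → refl

indexᴿ : (G : Realised 2) → (∀ d p → d < ⟦ G ⟧ (suc d ∷ p ∷ [])) → Realised 2
indexᴿ G unbounded =
  minᴿ (∸ᴿ ⟨ succᴿ ⟨ π₁ ⟩₁ , G ⟨ succᴿ ⟨ π₀ ⟩₁ , π₂ ⟩₂ ⟩₂) (binary λ d _ → d)
       λ { (d ∷ p ∷ []) → m≤n⇒m∸n≡0 (unbounded d p) }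

index₁ᴿ : (G : Realised 1) → (∀ d → d < ⟦ G ⟧₁ (suc d)) → Realised 1
index₁ᴿ G unbounded = indexᴿ (G ⟨ π₀ ⟩₁) (λ d _ → unbounded d) ⟨ π₀ , zeroᴿ ⟩₂

-- Each realiser computes its namesake definitionally, so evaluates skipRuleᴿ already has
-- the type required by Computable.
skipRule-computable : Computable skipRule
skipRule-computable = code skipRuleᴿ , λ σ → evaluates skipRuleᴿ (encode σ ∷ [])
  where
  triangleᴿ bᴿ diagonalᴿ unpairʳᴿ unpairˡᴿ blockᴿ subBlockᴿ : Realised 1
  triangleᴿ = recursionᴿ triangle (+ᴿ ⟨ π₁ , succᴿ ⟨ π₀ ⟩₁ ⟩₂) λ _ → refl
  bᴿ        = recursionᴿ b (+ᴿ ⟨ π₁ , ^ᴿ 4 ⟨ π₀ ⟩₁ ⟩₂) λ _ → refl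
  diagonalᴿ = index₁ᴿ triangleᴿ (IsPartition.unbounded triangle-partition)
  unpairʳᴿ  = ∸ᴿ ⟨ π₀ , triangleᴿ ⟨ diagonalᴿ ⟩₁ ⟩₂
  unpairˡᴿ  = ∸ᴿ ⟨ diagonalᴿ , unpairʳᴿ ⟩₂
  blockᴿ    = index₁ᴿ bᴿ (IsPartition.unbounded b-partition)
  subBlockᴿ = indexᴿ (*ᴿ ⟨ π₀ , ^ᴿ 2 ⟨ π₁ ⟩₁ ⟩₂) (λ r n → IsPartition.unbounded (scale-partition n) r)
                ⟨ ∸ᴿ ⟨ π₀ , bᴿ ⟨ blockᴿ ⟩₁ ⟩₂ , blockᴿ ⟩₂

  headCodeᴿ tailCodeᴿ lastCodeᴿ nextSubBlockᴿ nextFromHeadᴿ skipRuleᴿ : Realised 1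
  headCodeᴿ     = unpairˡᴿ ⟨ predᴿ ⟩₁
  tailCodeᴿ     = unpairʳᴿ ⟨ predᴿ ⟩₁
  lastCodeᴿ     = iterateᴿ (ifZeroᴿ ⟨ tailCodeᴿ , π₀ , tailCodeᴿ ⟩₃) ⟨ π₀ , π₀ ⟩₂
  nextSubBlockᴿ = +ᴿ ⟨ bᴿ ⟨ blockᴿ ⟩₁ , *ᴿ ⟨ succᴿ ⟨ subBlockᴿ ⟩₁ , ^ᴿ 2 ⟨ blockᴿ ⟩₁ ⟩₂ ⟩₂
  nextFromHeadᴿ = ifZeroᴿ ⟨ unpairʳᴿ , nextSubBlockᴿ ⟨ unpairˡᴿ ⟩₁ , succᴿ ⟨ unpairˡᴿ ⟩₁ ⟩₃
  skipRuleᴿ     = ifZeroᴿ ⟨ π₀ , zeroᴿ , nextFromHeadᴿ ⟨ headCodeᴿ ⟨ lastCodeᴿ ⟩₁ ⟩₁ ⟩₃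

-- Running the skip rule on A

increasing-hits : ∀ (f : ℕ → ℕ) {s} → (∀ k → f k < f (suc k)) → f 0 ≤ s →
                  (∀ k → f k < s → f (suc k) ≤ s) → ∃ λ k → f k ≡ s
increasing-hits f {s} increasing f0≤s no-jump =
  [ id , (λ fs<s → ⊥-elim (≤⇒≯ (k≤f s) fs<s)) ]′ (below-or-hit s)
  where
  k≤f : ∀ k → k ≤ f k
  k≤f zero    = z≤n
  k≤f (suc k) = ≤-<-trans (k≤f k) (increasing k)

  below-or-hit : ∀ k → (∃ λ j → f j ≡ s) ⊎ f k < s
  below-or-hit zero with m≤n⇒m<n∨m≡n f0≤s
  ... | inj₁ f0<s = inj₂ f0<s
  ... | inj₂ f0≡s = inj₁ (0 , f0≡s)
  below-or-hit (suc k) with below-or-hit k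
  ... | inj₁ hit = inj₁ hit
  ... | inj₂ fk<s with m≤n⇒m<n∨m≡n (no-jump k fk<s)
  ...   | inj₁ fk+1<s = inj₂ fk+1<s
  ...   | inj₂ fk+1≡s = inj₁ (suc k , fk+1≡s)

count-suc : ∀ B n → count B (suc n) ≡ bit (B n) + count B n
count-suc B n with B n
... | true  = refl
... | false = refl

module Selection (A : Set⊆ω) where

  d : ℕ → ℕ
  d = query skipRule A

  selected : Set⊆ω
  selected = select skipRule A

  d-suc : ∀ k → d (suc k) ≡ next (d k) (A (d k))
  d-suc k = skipRule-snoc (history skipRule A k) (d k) (A (d k))

  d-reaches : ∀ {n i} → i < 2 ^ n → ∃ λ k → d k ≡ subBlockStart n i
  d-reaches {n} {i} i<2ⁿ = increasing-hits d increasing z≤n no-jump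
    where
    increasing : ∀ k → d k < d (suc k)
    increasing k = subst (d k <_) (sym (d-suc k)) (<-next (d k) (A (d k)))

    no-jump : ∀ k → d k < subBlockStart n i → d (suc k) ≤ subBlockStart n i
    no-jump k dₖ<s = subst (_≤ subBlockStart n i) (sym (d-suc k)) (next-≤ {n} i<2ⁿ (A (d k)) dₖ<s)

  -- Every query either is selected or moves on to a later sub-block.
  k≤selected+potential : ∀ k → k ≤ count selected k + potential (d k)
  k≤selected+potential zero    = z≤n
  k≤selected+potential (suc k) = begin
    suc k                           ≤⟨ s≤s (k≤selected+potential k) ⟩
    suc (z + potential (d k))       ≡⟨ +-suc z _ ⟨
    z + suc (potential (d k))       ≤⟨ +-monoʳ-≤ z (potential-next (d k) c) ⟩
    z + (bit c + potential next-d)  ≡⟨ +-assoc-comm z (bit c) _ ⟩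
    (bit c + z) + potential next-d  ≡⟨ cong₂ _+_ (count-suc selected k) (cong potential (d-suc k)) ⟨
    count selected (suc k) + potential (d (suc k))  ∎
    where
    open ≤-Reasoning
    c : Bool
    c = A (d k)
    z next-d : ℕ
    z = count selected k
    next-d = next (d k) c
    +-assoc-comm : ∀ x y w → x + (y + w) ≡ (y + x) + w
    +-assoc-comm x y w = trans (sym (+-assoc x y w)) (cong (_+ w) (+-comm x y))

  selected-step : ∀ k → A (d k) ≡ true → d (suc k) ≡ suc (d k) × count selected (suc k) ≡ suc (count selected k)
  selected-step k Adₖ = trans (d-suc k) (cong (next (d k)) Adₖ) ,
                        trans (count-suc selected k) (cong (λ c → bit c + count selected k) Adₖ)

  selected-run : ∀ {k₀ L} → (∀ j → j < L → A (d k₀ + j) ≡ true) →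
                 ∀ j → j ≤ L → d (j + k₀) ≡ d k₀ + j × count selected (j + k₀) ≡ j + count selected k₀
  selected-run ones zero    _   = sym (+-identityʳ _) , refl
  selected-run {k₀} ones (suc j) j<L =
    trans (proj₁ step) (trans (cong suc (proj₁ run)) (sym (+-suc (d k₀) j))) ,
    trans (proj₂ step) (cong suc (proj₂ run))
    where
    run : d (j + k₀) ≡ d k₀ + j × count selected (j + k₀) ≡ j + count selected k₀
    run = selected-run ones j (<⇒≤ j<L)
    step : d (suc j + k₀) ≡ suc (d (j + k₀)) × count selected (suc j + k₀) ≡ suc (count selected (j + k₀))
    step = selected-step (j + k₀) (trans (cong A (proj₁ run)) (ones j j<L))

  subBlock-selected : ∀ {n i k₀} → i < 2 ^ n → BlockIsSubBlock A n i → d k₀ ≡ subBlockStart n i →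
                      count selected (2 ^ n + k₀) ≡ 2 ^ n + count selected k₀
  subBlock-selected {n} {i} {k₀} i<2ⁿ A∩block dₖ₀≡s = proj₂ (selected-run ones (2 ^ n) ≤-refl)
    where
    s : ℕ
    s = subBlockStart n i

    ones : ∀ j → j < 2 ^ n → A (d k₀ + j) ≡ true
    ones j j<2ⁿ = subst (λ x → A x ≡ true) (cong (_+ j) (sym dₖ₀≡s)) (proj₂ (A∩block (s + j) in-block) in-sub)
      where
      in-sub : InSubBlock n i (s + j)
      in-sub = m≤m+n s j , subst (s + j <_) (sym (subBlockStart-suc n i)) (+-monoʳ-< s j<2ⁿ)
      in-block : InBlock n (s + j)
      in-block = ≤-trans (b≤subBlockStart n i) (proj₁ in-sub) , <-≤-trans (proj₂ in-sub) (subBlockStart≤b n i<2ⁿ)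

  dense-prefix : ∀ {n i} → i < 2 ^ n → BlockIsSubBlock A n i →
                 ∃ λ m → n ≤ m × suc m ≤ count selected (suc m) * 4
  dense-prefix {n} {i} i<2ⁿ A∩block =
    pred K , n≤pred-K , subst (λ K → K ≤ count selected K * 4) (sym suc-pred-K) K≤4count
    where
    k₀ : ℕ
    k₀ = proj₁ (d-reaches {n} i<2ⁿ)
    dₖ₀≡s : d k₀ ≡ subBlockStart n i
    dₖ₀≡s = proj₂ (d-reaches {n} i<2ⁿ)
    a z K : ℕ
    a = 2 ^ n
    z = count selected k₀
    K = a + k₀

    k₀≤ : k₀ ≤ z + (a + i)
    k₀≤ = subst (λ p → k₀ ≤ z + p) (trans (cong potential dₖ₀≡s) (potential-subBlockStart n (<⇒≤ i<2ⁿ)))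
                (k≤selected+potential k₀)

    K≤4count : K ≤ count selected K * 4
    K≤4count = begin
      a + k₀                                   ≤⟨ +-monoʳ-≤ a k₀≤ ⟩
      a + (z + (a + i))                        ≤⟨ +-monoʳ-≤ a (+-monoʳ-≤ z (+-monoʳ-≤ a (<⇒≤ i<2ⁿ))) ⟩
      a + (z + (a + a))                        ≤⟨ m≤m+n _ (a + (z + (z + z))) ⟩
      a + (z + (a + a)) + (a + (z + (z + z)))  ≡⟨ four-quarters a z ⟩
      (a + z) * 4                              ≡⟨ cong (_* 4) (subBlock-selected {n} {i} {k₀} i<2ⁿ A∩block dₖ₀≡s) ⟨
      count selected K * 4                     ∎
      where
      open ≤-Reasoning
      four-quarters : ∀ a z → a + (z + (a + a)) + (a + (z + (z + z))) ≡ (a + z) * 4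
      four-quarters = solve-∀

    suc-pred-K : suc (pred K) ≡ K
    suc-pred-K = suc-pred K {{>-nonZero (≤-trans (m^n>0 2 n) (m≤m+n a k₀))}}

    n≤pred-K : n ≤ pred K
    n≤pred-K = ≤-pred (subst (n <_) (sym suc-pred-K) (≤-trans (n<2^n n) (m≤m+n a k₀)))

-- Density

¼ : ℚ.ℚ
¼ = ℤ.+ 1 ℚ./ 4

0<¼ : 0ℚ ℚ.< ¼
0<¼ = ℚₚ.toℚᵘ-cancel-< (ℚᵘ.*<* (ℤ.+<+ (s≤s z≤n)))

ρsuc-not-small : ∀ B m → suc m ≤ count B (suc m) * 4 → ¬ (∣ ρsuc B m ℚ.- 0ℚ ∣ ℚ.< ¼)
ρsuc-not-small B m dense small = ℚₚ.<-irrefl refl (ℚₚ.<-≤-trans small (subst (¼ ℚ.≤_) (sym ∣ρ-0∣≡ρ) ¼≤ρ))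
  where
  c : ℕ
  c = count B (suc m)
  ¼≤ρ : ¼ ℚ.≤ ρsuc B m
  ¼≤ρ = ℚₚ.toℚᵘ-cancel-≤ (ℚᵘₚ.≤-respʳ-≃ (ℚᵘₚ.≃-sym (ℚₚ.toℚᵘ-fromℚᵘ (ℚᵘ.mkℚᵘ (ℤ.+ c) m)))
          (ℚᵘ.*≤* (subst₂ ℤ._≤_ (ℤₚ.pos-* 1 (suc m)) (ℤₚ.pos-* c 4)
            (ℤ.+≤+ (subst (_≤ c * 4) (sym (+-identityʳ (suc m))) dense)))))
  ∣ρ-0∣≡ρ : ∣ ρsuc B m ℚ.- 0ℚ ∣ ≡ ρsuc B m
  ∣ρ-0∣≡ρ = trans (cong ∣_∣ (ℚₚ.+-identityʳ _)) (ℚₚ.0≤p⇒∣p∣≡p (ℚₚ.≤-trans (ℚₚ.<⇒≤ 0<¼) ¼≤ρ))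

lemma4 : (A : Set⊆ω) →
    (∀ m → Σ ℕ λ n → m ≤ n × Σ ℕ λ i → i < 2 ^ n × BlockIsSubBlock A n i) →
    ¬ ZeroWeaklyStochastic A
lemma4 A often stochastic =
  let N , small                    = stochastic skipRule skipRule-isSkipRule skipRule-computable ¼ 0<¼
      n , N≤n , i , i<2ⁿ , A∩block = often N
      m , n≤m , dense              = Selection.dense-prefix A {n} i<2ⁿ A∩block
  in  ρsuc-not-small (Selection.selected A) m dense (small m (≤-trans N≤n n≤m))
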